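{- Let $G$ be an $n$-vertex simple graph with a proper edge-coloring containing no rainbow copy of $P_5$. Then each edge of $G$ is contained in at most $4! = 24$ rainbow copies of $C_5$.
   Context: An edge-coloring is proper if any two edges sharing a vertex receive different colors. An edge-colored subgraph is rainbow if no two of its edges have the same color. $P_5$ denotes the path with $5$ edges ($6$ vertices) and $C_5$ the cycle of length $5$; copies are counted as subgraphs. -}

module Defs where

open import Data.Nat using (ℕ)
open import Data.Bool using (Bool; true; false)
open import Data.Fin using (Fin; zero; suc; inject₁)
open import Data.Vec using (Vec; lookup; _∷_)
open import Data.Product using (_×_; ∃)
open import Relation.Binary.PropositionalEquality using (_≡_; _≢_)
open import Function.Definitions using (Injective)
open import Relation.Nullary using (¬_)

record SimpleGraph (n : ℕ) : Set where
  field
    adj   : Fin n → Fin n → Bool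
    sym   : ∀ u v → adj u v ≡ adj v u
    irrefl : ∀ v → adj v v ≡ false
open SimpleGraph public

-- An edge-colouring assigns a colour (a natural number) to each vertex pair;
-- only values on edges matter.  Symmetric, so it is a function of the edge {u,v}.
record EdgeColouring {n : ℕ} (G : SimpleGraph n) : Set where
  field
    col    : Fin n → Fin n → ℕ
    colSym : ∀ u v → col u v ≡ col v u
open EdgeColouring public

Edge : ∀ {n} → SimpleGraph n → Fin n → Fin n → Set
Edge G u v = adj G u v ≡ true

Proper : ∀ {n} {G : SimpleGraph n} → EdgeColouring G → Set
Proper {n} {G} c = ∀ (u v w : Fin n) → Edge G u v → Edge G u w → v ≢ w → col c u v ≢ col c u w

-- A rainbow copy of P5 (path with 5 edges, 6 distinct vertices v0..v5)
RainbowP5 : ∀ {n} {G : SimpleGraph n} → EdgeColouring G → Vec (Fin n) 6 → Set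
RainbowP5 {n} {G} c vs =
  Injective _≡_ _≡_ (lookup vs)
  × (∀ (i : Fin 5) → Edge G (lookup vs (inject₁ i)) (lookup vs (suc i)))
  × Injective _≡_ _≡_ (λ (i : Fin 5) → col c (lookup vs (inject₁ i)) (lookup vs (suc i)))

NoRainbowP5 : ∀ {n} {G : SimpleGraph n} → EdgeColouring G → Set
NoRainbowP5 {n} c = ¬ ∃ (λ (vs : Vec (Fin n) 6) → RainbowP5 c vs)

next5 : Fin 5 → Fin 5
next5 zero = suc zero
next5 (suc zero) = suc (suc zero)
next5 (suc (suc zero)) = suc (suc (suc zero))
next5 (suc (suc (suc zero))) = suc (suc (suc (suc zero)))
next5 (suc (suc (suc (suc zero)))) = zero

RainbowC5 : ∀ {n} {G : SimpleGraph n} → EdgeColouring G → Vec (Fin n) 5 → Set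
RainbowC5 {n} {G} c vs =
  Injective _≡_ _≡_ (lookup vs)
  × (∀ (i : Fin 5) → Edge G (lookup vs i) (lookup vs (next5 i)))
  × Injective _≡_ _≡_ (λ (i : Fin 5) → col c (lookup vs i) (lookup vs (next5 i)))

-- Rainbow copies of C5 containing the edge {a,b}: each such copy (as a subgraph)
-- corresponds to exactly one cyclic vertex sequence starting a, b, … .
RainbowC5Through : ∀ {n} {G : SimpleGraph n} → EdgeColouring G → Fin n → Fin n → Vec (Fin n) 5 → Set
RainbowC5Through c a b vs = RainbowC5 c vs × lookup vs zero ≡ a × lookup vs (suc zero) ≡ b

-- A rainbow C₅ through ab is a rainbow pentagon a b x y z, and we count the triples (x, y, z).
-- Every bound comes from a path that would be a rainbow P₅, combined with properness: the edges
-- at a vertex have distinct colours, so a vertex has at most k neighbours joined to it by edges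
-- with colours in a given set of k colours.  For two completions z ≠ z′ of a b x y the path
-- z′ y x b a z forces C(y z′) = C(z a), so a third completion would repeat a colour at y: at most
-- two z.  Four values of y for fixed a b x would contain a pair completing each other or a chain
-- y₁ → y₂ → y₃ of completions, and both are excluded: at most three y.  Finally, a case analysis
-- on the chords ax, bz, ay shows that at one endpoint, say b, all edges to vertices other than a
-- use only four colours: at most four x.  Hence 4 · 3 · 2 = 24, reading the cycles backwards when
-- the small endpoint is a.
module Submission where

open import Defs hiding (sym)

import Data.Bool as Bool
open import Data.Empty using (⊥; ⊥-elim)
open import Data.Fin using (Fin; zero; suc; inject₁)
import Data.Fin.Properties as Fin
open import Data.List as List using (List; []; _∷_; length; map; filter; deduplicate)
open import Data.List.Membership.Propositional using (_∈_)
open import Data.List.Membership.Propositional.Properties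
  using (∈-map⁺; ∈-map⁻; ∈-deduplicate⁺; ∈-deduplicate⁻; ∈-filter⁻)
open import Data.List.Relation.Binary.Sublist.Propositional.Properties using (filter-⊆; filter⁺; length-mono-≤)
open import Data.List.Relation.Unary.All as All using (All; _∷_)
open import Data.List.Relation.Unary.AllPairs using (_∷_)
open import Data.List.Relation.Unary.Any using (here; there; index)
open import Data.List.Relation.Unary.Any.Properties using (lookup-index)
open import Data.List.Relation.Unary.Unique.DecPropositional.Properties using (deduplicate-!)
open import Data.List.Relation.Unary.Unique.Propositional using (Unique)
import Data.List.Relation.Unary.Unique.Propositional.Properties as Unique
open import Data.Nat as ℕ using (ℕ; zero; suc; _≤_; z≤n; s≤s; _+_; _*_)
open import Data.Nat.Properties using (≤-refl; ≤-trans; +-mono-≤; *-monoˡ-≤; _≤?_; ≰⇒>; +-suc; module ≤-Reasoning)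
open import Data.Product using (Σ-syntax; _×_; _,_; proj₁; proj₂)
open import Data.Sum using (_⊎_; inj₁; inj₂; [_,_]′)
open import Data.Vec using (Vec; []; _∷_; lookup)
open import Data.Vec.Relation.Unary.All using ([]; _∷_) renaming (All to Allᵛ)
import Data.Vec.Relation.Unary.All.Properties as Allᵛ
open import Data.Vec.Relation.Unary.AllPairs using ([]; _∷_)
open import Data.Vec.Relation.Unary.Unique.Propositional using () renaming (Unique to Uniqueᵛ)
open import Data.Vec.Relation.Unary.Unique.Propositional.Properties
  using (tabulate⁺) renaming (lookup-injective to lookupᵛ-injective)
open import Function using (id; _∘_)
open import Function.Definitions using (Injective)
open import Relation.Binary.Definitions using (DecidableEquality)
open import Relation.Binary.PropositionalEquality
  using (_≡_; _≢_; refl; sym; trans; cong; cong₂; subst; subst₂; ≢-sym)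
open import Relation.Nullary using (¬_; Dec; yes; no)
open import Relation.Unary using (Decidable)
open import Relation.Unary.Properties using (∁?)

Distinct : {A : Set} → ℕ → (A → Set) → Set
Distinct {A} k P = Σ[ f ∈ (Fin k → A) ] Injective _≡_ _≡_ f × (∀ i → P (f i))

AtMost : {A : Set} → ℕ → (A → Set) → Set
AtMost k P = ¬ Distinct (suc k) P

module _ {A : Set} where

  Uniqueᵛ⇒Distinct : ∀ {k} {P : A → Set} (vs : Vec A k) → Uniqueᵛ vs → Allᵛ P vs → Distinct k P
  Uniqueᵛ⇒Distinct vs u ps = lookup vs , lookupᵛ-injective u _ _ , Allᵛ.lookup⁺ ps

  Unique⇒Distinct : ∀ {k} (xs : List A) → Unique xs → k ≤ length xs → Distinct k (_∈ xs)
  Unique⇒Distinct {zero} xs _ _ = (λ ()) , (λ { {()} }) , (λ ())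
  Unique⇒Distinct {suc k} (x ∷ xs) (x∉xs ∷ u) (s≤s k≤) with Unique⇒Distinct xs u k≤
  ... | f , f-inj , f∈ = f′ , f′-inj , f′∈
    where
    f′ : Fin (suc k) → A
    f′ zero = x
    f′ (suc i) = f i
    f′-inj : Injective _≡_ _≡_ f′
    f′-inj {zero} {zero} _ = refl
    f′-inj {zero} {suc j} x≡fj = ⊥-elim (All.lookup x∉xs (f∈ j) x≡fj)
    f′-inj {suc i} {zero} fi≡x = ⊥-elim (All.lookup x∉xs (f∈ i) (sym fi≡x))
    f′-inj {suc i} {suc j} fi≡fj = cong suc (f-inj fi≡fj)
    f′∈ : ∀ i → f′ i ∈ x ∷ xs
    f′∈ zero = here refl
    f′∈ (suc i) = there (f∈ i)

  Distinct-map : ∀ {B : Set} {k} {P : A → Set} {Q : B → Set} (g : A → B) →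
                 (∀ {x y} → P x → P y → g x ≡ g y → x ≡ y) → (∀ {x} → P x → Q (g x)) →
                 Distinct k P → Distinct k Q
  Distinct-map g g-inj P⇒Qg (f , f-inj , Pf) = g ∘ f , f-inj ∘ g-inj (Pf _) (Pf _) , P⇒Qg ∘ Pf

  Distinct-weaken : ∀ {k} {P Q : A → Set} → (∀ {x} → P x → Q x) → Distinct k P → Distinct k Q
  Distinct-weaken = Distinct-map id (λ _ _ → id)

  length-≤-via : ∀ {B : Set} {k} {Q : B → Set} (g : A → B) (xs : List A) → Unique xs →
                 (∀ {x y} → x ∈ xs → y ∈ xs → g x ≡ g y → x ≡ y) → (∀ {x} → x ∈ xs → Q (g x)) →
                 AtMost k Q → length xs ≤ k
  length-≤-via {k = k} {Q} g xs u g-inj Qg few with length xs ≤? k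
  ... | yes ≤k = ≤k
  ... | no ≰k = ⊥-elim (few (Distinct-map {Q = Q} g g-inj Qg (Unique⇒Distinct xs u (≰⇒> ≰k))))

  length-≤ : ∀ {k} {P : A → Set} (xs : List A) → Unique xs → All P xs → AtMost k P → length xs ≤ k
  length-≤ xs u ps = length-≤-via id xs u (λ _ _ → id) (All.lookup ps)

  length-filter-∁ : ∀ {P : A → Set} (P? : Decidable P) xs →
                    length xs ≡ length (filter P? xs) + length (filter (∁? P?) xs)
  length-filter-∁ P? [] = refl
  length-filter-∁ P? (x ∷ xs) with P? x
  ... | yes _ = cong suc (length-filter-∁ P? xs)
  ... | no _ = trans (cong suc (length-filter-∁ P? xs)) (sym (+-suc _ _))

module _ {A B : Set} (_≟_ : DecidableEquality B) (f : A → B) where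

  image : List A → List B
  image xs = deduplicate _≟_ (map f xs)

  fibre : B → List A → List A
  fibre y = filter (λ x → f x ≟ y)

  image-unique : ∀ xs → Unique (image xs)
  image-unique xs = deduplicate-! _≟_ (map f xs)

  ∈-image⁻ : ∀ {y xs} → y ∈ image xs → Σ[ x ∈ A ] x ∈ xs × y ≡ f x
  ∈-image⁻ {xs = xs} y∈ = ∈-map⁻ f (∈-deduplicate⁻ _≟_ (map f xs) y∈)

  ∈-image⁺ : ∀ {x xs} → x ∈ xs → f x ∈ image xs
  ∈-image⁺ x∈ = ∈-deduplicate⁺ _≟_ (∈-map⁺ f x∈)

  ∈-fibre⁻ : ∀ {x y xs} → x ∈ fibre y xs → x ∈ xs × f x ≡ y
  ∈-fibre⁻ = ∈-filter⁻ (λ x → f x ≟ _)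

  private
    length-≤-cover : ∀ {k} (ys : List B) xs → All (λ x → f x ∈ ys) xs →
                     (∀ y → length (fibre y xs) ≤ k) → length xs ≤ length ys * k
    length-≤-cover [] [] _ _ = z≤n
    length-≤-cover [] (x ∷ xs) (() ∷ _) _
    length-≤-cover {k} (y ∷ ys) xs covered bounded = begin
      length xs                                          ≡⟨ length-filter-∁ (λ x → f x ≟ y) xs ⟩
      length (fibre y xs) + length rest                  ≤⟨ +-mono-≤ (bounded y) (length-≤-cover ys rest covered′ bounded′) ⟩
      k + length ys * k                                  ∎
      where
      open ≤-Reasoning
      rest : List A
      rest = filter (∁? (λ x → f x ≟ y)) xs
      covered′ : All (λ x → f x ∈ ys) rest
      covered′ = All.tabulate λ x∈rest → let x∈xs , fx≢y = ∈-filter⁻ (∁? (λ x → f x ≟ y)) x∈rest in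
        tail-∈ (All.lookup covered x∈xs) fx≢y
        where
        tail-∈ : ∀ {z} → z ∈ y ∷ ys → z ≢ y → z ∈ ys
        tail-∈ (here z≡y) z≢y = ⊥-elim (z≢y z≡y)
        tail-∈ (there z∈ys) _ = z∈ys
      bounded′ : ∀ y′ → length (fibre y′ rest) ≤ k
      bounded′ y′ = ≤-trans (length-mono-≤ (filter⁺ _ _ (λ { refl fx≡y′ → fx≡y′ }) (filter-⊆ _ xs))) (bounded y′)

  length-≤-image*fibre : ∀ {k} xs → (∀ y → length (fibre y xs) ≤ k) → length xs ≤ length (image xs) * k
  length-≤-image*fibre xs = length-≤-cover (image xs) xs (All.tabulate ∈-image⁺)

  fibre-unique : ∀ {y xs} → Unique xs → Unique (fibre y xs)
  fibre-unique = Unique.filter⁺ (λ x → f x ≟ _)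

module _ {A B : Set} (_≟_ : DecidableEquality B) where

  length-≤-triples : ∀ {k₁ k₂ k₃} {R : B → B → B → Set} (p q r : A → B) (build : B × B × B → A) (cs : List A) →
                     Unique cs → (∀ {v} → v ∈ cs → R (p v) (q v) (r v)) → (∀ {v} → v ∈ cs → v ≡ build (p v , q v , r v)) →
                     AtMost k₁ (λ x → Σ[ y ∈ B ] Σ[ z ∈ B ] R x y z) →
                     (∀ {x} → AtMost k₂ (λ y → Σ[ z ∈ B ] R x y z)) →
                     (∀ {x y} → AtMost k₃ (R x y)) →
                     length cs ≤ k₁ * (k₂ * k₃)
  length-≤-triples {k₁} {k₂} {k₃} {R} p q r build cs cs-unique R-pqr built few₁ few₂ few₃ = begin
    length cs                           ≤⟨ length-≤-image*fibre _≟_ p cs per-x ⟩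
    length (image _≟_ p cs) * (k₂ * k₃)  ≤⟨ *-monoˡ-≤ (k₂ * k₃) (length-≤ _ (image-unique _≟_ p cs) (All.tabulate first) few₁) ⟩
    k₁ * (k₂ * k₃)                      ∎
    where
    open ≤-Reasoning
    first : ∀ {x} → x ∈ image _≟_ p cs → Σ[ y ∈ B ] Σ[ z ∈ B ] R x y z
    first x∈ with ∈-image⁻ _≟_ p x∈
    ... | v , v∈ , refl = q v , r v , R-pqr v∈

    per-x : ∀ x → length (fibre _≟_ p x cs) ≤ k₂ * k₃
    per-x x = begin
      length csₓ                    ≤⟨ length-≤-image*fibre _≟_ q csₓ per-y ⟩
      length (image _≟_ q csₓ) * k₃  ≤⟨ *-monoˡ-≤ k₃ (length-≤ _ (image-unique _≟_ q csₓ) (All.tabulate second) few₂) ⟩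
      k₂ * k₃                       ∎
      where
      csₓ : List A
      csₓ = fibre _≟_ p x cs
      R-x : ∀ {v} → v ∈ csₓ → R x (q v) (r v)
      R-x v∈ with ∈-fibre⁻ _≟_ p v∈
      ... | v∈cs , pv≡x = subst (λ x′ → R x′ _ _) pv≡x (R-pqr v∈cs)
      second : ∀ {y} → y ∈ image _≟_ q csₓ → Σ[ z ∈ B ] R x y z
      second y∈ with ∈-image⁻ _≟_ q y∈
      ... | v , v∈ , refl = r v , R-x v∈

      per-y : ∀ y → length (fibre _≟_ q y csₓ) ≤ k₃
      per-y y = length-≤-via {Q = R x y} r _ (fibre-unique _≟_ q (fibre-unique _≟_ p cs-unique)) r-injective R-xy few₃
        where
        coordinates : ∀ {v} → v ∈ fibre _≟_ q y csₓ → v ≡ build (x , y , r v)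
        coordinates {v} v∈ with ∈-fibre⁻ _≟_ q v∈
        ... | v∈csₓ , qv≡y with ∈-fibre⁻ _≟_ p v∈csₓ
        ...   | v∈cs , pv≡x = trans (built v∈cs) (cong₂ (λ x′ y′ → build (x′ , y′ , r v)) pv≡x qv≡y)
        R-xy : ∀ {v} → v ∈ fibre _≟_ q y csₓ → R x y (r v)
        R-xy v∈ with ∈-fibre⁻ _≟_ q v∈
        ... | v∈csₓ , qv≡y = subst (λ y′ → R x y′ _) qv≡y (R-x v∈csₓ)
        r-injective : ∀ {v w} → v ∈ fibre _≟_ q y csₓ → w ∈ fibre _≟_ q y csₓ → r v ≡ r w → v ≡ w
        r-injective v∈ w∈ rv≡rw = trans (coordinates v∈) (trans (cong (λ z → build (x , y , z)) rv≡rw) (sym (coordinates w∈)))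

-- Rainbow pentagons in a properly coloured graph

module Colouring {n : ℕ} {G : SimpleGraph n} (c : EdgeColouring G) where

  E : Fin n → Fin n → Set
  E = Edge G

  C : Fin n → Fin n → ℕ
  C = col c

  E-sym : ∀ {u v} → E u v → E v u
  E-sym {u} {v} u~v = trans (SimpleGraph.sym G v u) u~v

  E-irrefl : ∀ {u v} → E u v → u ≢ v
  E-irrefl {u} u~u refl with trans (sym u~u) (irrefl G u)
  ... | ()

  C-sym : ∀ u v → C u v ≡ C v u
  C-sym = colSym c

  record RainbowPentagon (a b x y z : Fin n) : Set where
    field
      a≢b : a ≢ b
      a≢x : a ≢ x
      a≢y : a ≢ y
      a≢z : a ≢ z
      b≢x : b ≢ x
      b≢y : b ≢ y
      b≢z : b ≢ z
      x≢y : x ≢ y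
      x≢z : x ≢ z
      y≢z : y ≢ z
      a~b : E a b
      b~x : E b x
      x~y : E x y
      y~z : E y z
      z~a : E z a
      ab≢bx : C a b ≢ C b x
      ab≢xy : C a b ≢ C x y
      ab≢yz : C a b ≢ C y z
      ab≢za : C a b ≢ C z a
      bx≢xy : C b x ≢ C x y
      bx≢yz : C b x ≢ C y z
      bx≢za : C b x ≢ C z a
      xy≢yz : C x y ≢ C y z
      xy≢za : C x y ≢ C z a
      yz≢za : C y z ≢ C z a

  reverse : ∀ {a b x y z} → RainbowPentagon a b x y z → RainbowPentagon b a z y x
  reverse {a} {b} {x} {y} {z} g = record
    { a≢b = ≢-sym a≢b ; a≢x = b≢z ; a≢y = b≢y ; a≢z = b≢x ; b≢x = a≢z ; b≢y = a≢y ; b≢z = a≢x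
    ; x≢y = ≢-sym y≢z ; x≢z = ≢-sym x≢z ; y≢z = ≢-sym x≢y
    ; a~b = E-sym a~b ; b~x = E-sym z~a ; x~y = E-sym y~z ; y~z = E-sym x~y ; z~a = E-sym b~x
    ; ab≢bx = flip ab≢za        ; ab≢xy = flip ab≢yz        ; ab≢yz = flip ab≢xy        ; ab≢za = flip ab≢bx
    ; bx≢xy = flip (≢-sym yz≢za) ; bx≢yz = flip (≢-sym xy≢za) ; bx≢za = flip (≢-sym bx≢za)
    ; xy≢yz = flip (≢-sym xy≢yz) ; xy≢za = flip (≢-sym bx≢yz) ; yz≢za = flip (≢-sym bx≢xy)
    }
    where
    open RainbowPentagon g
    flip : ∀ {p q r s} → C p q ≢ C r s → C q p ≢ C s r
    flip {p} {q} {r} {s} = subst₂ _≢_ (C-sym p q) (C-sym r s)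

  vertex₂ vertex₃ vertex₄ : Vec (Fin n) 5 → Fin n
  vertex₂ vs = lookup vs (suc (suc zero))
  vertex₃ vs = lookup vs (suc (suc (suc zero)))
  vertex₄ vs = lookup vs (suc (suc (suc (suc zero))))

  RainbowC5Through⇒≡ : ∀ {a b} vs → RainbowC5Through c a b vs → vs ≡ a ∷ b ∷ vertex₂ vs ∷ vertex₃ vs ∷ vertex₄ vs ∷ []
  RainbowC5Through⇒≡ (_ ∷ _ ∷ _ ∷ _ ∷ _ ∷ []) (_ , refl , refl) = refl

  RainbowC5Through⇒pentagon : ∀ {a b} vs → RainbowC5Through c a b vs →
                              RainbowPentagon a b (vertex₂ vs) (vertex₃ vs) (vertex₄ vs)
  RainbowC5Through⇒pentagon (_ ∷ _ ∷ _ ∷ _ ∷ _ ∷ []) ((vs-inj , edge , colour-inj) , refl , refl)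
    with tabulate⁺ vs-inj | tabulate⁺ colour-inj
  ... | (a≢b ∷ a≢x ∷ a≢y ∷ a≢z ∷ []) ∷ (b≢x ∷ b≢y ∷ b≢z ∷ []) ∷ (x≢y ∷ x≢z ∷ []) ∷ (y≢z ∷ []) ∷ [] ∷ []
      | (ab≢bx ∷ ab≢xy ∷ ab≢yz ∷ ab≢za ∷ []) ∷ (bx≢xy ∷ bx≢yz ∷ bx≢za ∷ []) ∷ (xy≢yz ∷ xy≢za ∷ []) ∷ (yz≢za ∷ []) ∷ [] ∷ []
    = record
    { a≢b = a≢b ; a≢x = a≢x ; a≢y = a≢y ; a≢z = a≢z ; b≢x = b≢x ; b≢y = b≢y ; b≢z = b≢z
    ; x≢y = x≢y ; x≢z = x≢z ; y≢z = y≢z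
    ; a~b = edge zero ; b~x = edge (suc zero) ; x~y = edge (suc (suc zero))
    ; y~z = edge (suc (suc (suc zero))) ; z~a = edge (suc (suc (suc (suc zero))))
    ; ab≢bx = ab≢bx ; ab≢xy = ab≢xy ; ab≢yz = ab≢yz ; ab≢za = ab≢za ; bx≢xy = bx≢xy
    ; bx≢yz = bx≢yz ; bx≢za = bx≢za ; xy≢yz = xy≢yz ; xy≢za = xy≢za ; yz≢za = yz≢za
    }

  module ProperColouring (proper : Proper c) where

    proper-at : ∀ {w u v} → E w u → E w v → u ≢ v → C w u ≢ C w v
    proper-at = proper _ _ _

    colour-injective : ∀ {w u v} → E w u → E w v → C w u ≡ C w v → u ≡ v
    colour-injective {u = u} {v} w~u w~v wu≡wv with u Fin.≟ v
    ... | yes u≡v = u≡v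
    ... | no u≢v = ⊥-elim (proper-at w~u w~v u≢v wu≡wv)

    atMost-palette : ∀ w (ks : List ℕ) → AtMost (length ks) (λ u → E w u × C w u ∈ ks)
    atMost-palette w ks (us , us-inj , us-ok) with Fin.pigeonhole ≤-refl (index ∘ proj₂ ∘ us-ok)
    ... | i , j , i<j , same-index = Fin.<⇒≢ i<j (us-inj (colour-injective (proj₁ (us-ok i)) (proj₁ (us-ok j)) same-colour))
      where
      same-colour : C w (us i) ≡ C w (us j)
      same-colour = trans (lookup-index (proj₂ (us-ok i)))
                          (trans (cong (List.lookup ks) same-index) (sym (lookup-index (proj₂ (us-ok j)))))

  module WithoutRainbowP₅ (proper : Proper c) (no-P₅ : NoRainbowP5 c) where

    open ProperColouring proper

    no-rainbow-path : ∀ (v₀ v₁ v₂ v₃ v₄ v₅ : Fin n) {k₁ k₂ k₃ k₄ k₅} →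
                      E v₀ v₁ → E v₁ v₂ → E v₂ v₃ → E v₃ v₄ → E v₄ v₅ →
                      C v₀ v₁ ≡ k₁ → C v₁ v₂ ≡ k₂ → C v₂ v₃ ≡ k₃ → C v₃ v₄ ≡ k₄ → C v₄ v₅ ≡ k₅ →
                      Uniqueᵛ (v₀ ∷ v₁ ∷ v₂ ∷ v₃ ∷ v₄ ∷ v₅ ∷ []) → Uniqueᵛ (k₁ ∷ k₂ ∷ k₃ ∷ k₄ ∷ k₅ ∷ []) → ⊥
    no-rainbow-path v₀ v₁ v₂ v₃ v₄ v₅ {k₁} {k₂} {k₃} {k₄} {k₅} e₁ e₂ e₃ e₄ e₅ c₁ c₂ c₃ c₄ c₅ vs-unique ks-unique =
      no-P₅ (vs , lookupᵛ-injective vs-unique _ _ , edge , colour-inj)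
      where
      vs : Vec (Fin n) 6
      vs = v₀ ∷ v₁ ∷ v₂ ∷ v₃ ∷ v₄ ∷ v₅ ∷ []
      ks : Vec ℕ 5
      ks = k₁ ∷ k₂ ∷ k₃ ∷ k₄ ∷ k₅ ∷ []
      edge : ∀ i → E (lookup vs (inject₁ i)) (lookup vs (suc i))
      edge zero = e₁
      edge (suc zero) = e₂
      edge (suc (suc zero)) = e₃
      edge (suc (suc (suc zero))) = e₄
      edge (suc (suc (suc (suc zero)))) = e₅
      colour≡k : ∀ i → C (lookup vs (inject₁ i)) (lookup vs (suc i)) ≡ lookup ks i
      colour≡k zero = c₁
      colour≡k (suc zero) = c₂
      colour≡k (suc (suc zero)) = c₃
      colour≡k (suc (suc (suc zero))) = c₄
      colour≡k (suc (suc (suc (suc zero)))) = c₅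
      colour-inj : Injective _≡_ _≡_ (λ i → C (lookup vs (inject₁ i)) (lookup vs (suc i)))
      colour-inj {i} {j} eq = lookupᵛ-injective ks-unique i j (trans (sym (colour≡k i)) (trans eq (colour≡k j)))

    edge-colour? : ∀ u v k → (E u v → C u v ≡ k) ⊎ (E u v × C u v ≢ k)
    edge-colour? u v k with adj G u v Bool.≟ Bool.true | C u v ℕ.≟ k
    ... | no u≁v | _ = inj₁ (⊥-elim ∘ u≁v)
    ... | yes _ | yes uv≡k = inj₁ (λ _ → uv≡k)
    ... | yes u~v | no uv≢k = inj₂ (u~v , uv≢k)

    module Pentagon {a b x y z : Fin n} (g : RainbowPentagon a b x y z) where

      open RainbowPentagon g

      module Outside {u : Fin n} (b~u : E b u) (u≢a : u ≢ a) (u≢x : u ≢ x) (u≢y : u ≢ y) (u≢z : u ≢ z) where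

        u≢b : u ≢ b
        u≢b = ≢-sym (E-irrefl b~u)

        bu≢bx : C b u ≢ C b x
        bu≢bx = proper-at b~u b~x u≢x

        colour : C b u ≡ C x y ⊎ C b u ≡ C y z ⊎ C b u ≡ C z a
        colour with C b u ℕ.≟ C x y | C b u ℕ.≟ C y z | C b u ℕ.≟ C z a
        ... | yes bu≡xy | _ | _ = inj₁ bu≡xy
        ... | no _ | yes bu≡yz | _ = inj₂ (inj₁ bu≡yz)
        ... | no _ | no _ | yes bu≡za = inj₂ (inj₂ bu≡za)
        ... | no bu≢xy | no bu≢yz | no bu≢za = ⊥-elim (no-rainbow-path u b x y z a
          (E-sym b~u) b~x x~y y~z z~a (C-sym u b) refl refl refl refl
          ((u≢b ∷ u≢x ∷ u≢y ∷ u≢z ∷ u≢a ∷ []) ∷ (b≢x ∷ b≢y ∷ b≢z ∷ ≢-sym a≢b ∷ []) ∷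
           (x≢y ∷ x≢z ∷ ≢-sym a≢x ∷ []) ∷ (y≢z ∷ ≢-sym a≢y ∷ []) ∷ (≢-sym a≢z ∷ []) ∷ [] ∷ [])
          ((bu≢bx ∷ bu≢xy ∷ bu≢yz ∷ bu≢za ∷ []) ∷ (bx≢xy ∷ bx≢yz ∷ bx≢za ∷ []) ∷
           (xy≢yz ∷ xy≢za ∷ []) ∷ (yz≢za ∷ []) ∷ [] ∷ []))

        chord-ax⇒≢xy : E a x → C a x ≢ C y z → C b u ≢ C x y
        chord-ax⇒≢xy a~x ax≢yz bu≡xy = no-rainbow-path u b x a z y
          (E-sym b~u) b~x (E-sym a~x) (E-sym z~a) (E-sym y~z) (C-sym u b) refl (C-sym x a) (C-sym a z) (C-sym z y)
          ((u≢b ∷ u≢x ∷ u≢a ∷ u≢z ∷ u≢y ∷ []) ∷ (b≢x ∷ ≢-sym a≢b ∷ b≢z ∷ b≢y ∷ []) ∷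
           (≢-sym a≢x ∷ x≢z ∷ x≢y ∷ []) ∷ (a≢z ∷ a≢y ∷ []) ∷ (≢-sym y≢z ∷ []) ∷ [] ∷ [])
          ((bu≢bx ∷ bu≢ax ∷ bu≢za ∷ bu≢yz ∷ []) ∷ (bx≢ax ∷ bx≢za ∷ bx≢yz ∷ []) ∷
           (ax≢za ∷ ax≢yz ∷ []) ∷ (≢-sym yz≢za ∷ []) ∷ [] ∷ [])
          where
          bu≢ax : C b u ≢ C a x
          bu≢ax bu≡ax = proper-at (E-sym a~x) x~y a≢y (trans (C-sym x a) (trans (sym bu≡ax) bu≡xy))
          bu≢za : C b u ≢ C z a
          bu≢za bu≡za = xy≢za (trans (sym bu≡xy) bu≡za)
          bu≢yz : C b u ≢ C y z
          bu≢yz bu≡yz = xy≢yz (trans (sym bu≡xy) bu≡yz)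
          bx≢ax : C b x ≢ C a x
          bx≢ax bx≡ax = proper-at (E-sym b~x) (E-sym a~x) (≢-sym a≢b) (trans (C-sym x b) (trans bx≡ax (C-sym a x)))
          ax≢za : C a x ≢ C z a
          ax≢za ax≡za = proper-at a~x (E-sym z~a) x≢z (trans ax≡za (C-sym z a))

        chord-ax⇒≢za : E a x → C a x ≢ C y z → C b u ≢ C z a
        chord-ax⇒≢za a~x ax≢yz bu≡za = no-rainbow-path u b a x y z
          (E-sym b~u) (E-sym a~b) a~x x~y y~z (C-sym u b) (C-sym b a) refl refl refl
          ((u≢b ∷ u≢a ∷ u≢x ∷ u≢y ∷ u≢z ∷ []) ∷ (≢-sym a≢b ∷ b≢x ∷ b≢y ∷ b≢z ∷ []) ∷
           (a≢x ∷ a≢y ∷ a≢z ∷ []) ∷ (x≢y ∷ x≢z ∷ []) ∷ (y≢z ∷ []) ∷ [] ∷ [])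
          ((bu≢ab ∷ bu≢ax ∷ bu≢xy ∷ bu≢yz ∷ []) ∷ (ab≢ax ∷ ab≢xy ∷ ab≢yz ∷ []) ∷
           (ax≢xy ∷ ax≢yz ∷ []) ∷ (xy≢yz ∷ []) ∷ [] ∷ [])
          where
          bu≢ab : C b u ≢ C a b
          bu≢ab bu≡ab = proper-at b~u (E-sym a~b) u≢a (trans bu≡ab (C-sym a b))
          bu≢ax : C b u ≢ C a x
          bu≢ax bu≡ax = proper-at (E-sym z~a) a~x (≢-sym x≢z) (trans (C-sym a z) (trans (sym bu≡za) bu≡ax))
          bu≢xy : C b u ≢ C x y
          bu≢xy bu≡xy = xy≢za (trans (sym bu≡xy) bu≡za)
          bu≢yz : C b u ≢ C y z
          bu≢yz bu≡yz = yz≢za (trans (sym bu≡yz) bu≡za)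
          ab≢ax : C a b ≢ C a x
          ab≢ax = proper-at a~b a~x b≢x
          ax≢xy : C a x ≢ C x y
          ax≢xy ax≡xy = proper-at (E-sym a~x) x~y a≢y (trans (C-sym x a) ax≡xy)

        chord-ay⇒≢yz : E a y → C a y ≢ C b x → C b u ≢ C y z
        chord-ay⇒≢yz a~y ay≢bx bu≡yz = no-rainbow-path u b x y a z
          (E-sym b~u) b~x x~y (E-sym a~y) (E-sym z~a) (C-sym u b) refl refl (C-sym y a) (C-sym a z)
          ((u≢b ∷ u≢x ∷ u≢y ∷ u≢a ∷ u≢z ∷ []) ∷ (b≢x ∷ b≢y ∷ ≢-sym a≢b ∷ b≢z ∷ []) ∷
           (x≢y ∷ ≢-sym a≢x ∷ x≢z ∷ []) ∷ (≢-sym a≢y ∷ y≢z ∷ []) ∷ (a≢z ∷ []) ∷ [] ∷ [])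
          ((bu≢bx ∷ bu≢xy ∷ bu≢ay ∷ bu≢za ∷ []) ∷ (bx≢xy ∷ ≢-sym ay≢bx ∷ bx≢za ∷ []) ∷
           (xy≢ay ∷ xy≢za ∷ []) ∷ (ay≢za ∷ []) ∷ [] ∷ [])
          where
          bu≢xy : C b u ≢ C x y
          bu≢xy bu≡xy = xy≢yz (trans (sym bu≡xy) bu≡yz)
          bu≢ay : C b u ≢ C a y
          bu≢ay bu≡ay = proper-at y~z (E-sym a~y) (≢-sym a≢z) (trans (sym bu≡yz) (trans bu≡ay (C-sym a y)))
          bu≢za : C b u ≢ C z a
          bu≢za bu≡za = yz≢za (trans (sym bu≡yz) bu≡za)
          xy≢ay : C x y ≢ C a y
          xy≢ay xy≡ay = proper-at (E-sym x~y) (E-sym a~y) (≢-sym a≢x) (trans (C-sym y x) (trans xy≡ay (C-sym a y)))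
          ay≢za : C a y ≢ C z a
          ay≢za ay≡za = proper-at a~y (E-sym z~a) y≢z (trans ay≡za (C-sym z a))

        palette-of-chord-ax : E a x → C a x ≢ C y z → C b u ∈ C b x ∷ C b y ∷ C b z ∷ C y z ∷ []
        palette-of-chord-ax a~x ax≢yz with colour
        ... | inj₁ bu≡xy = ⊥-elim (chord-ax⇒≢xy a~x ax≢yz bu≡xy)
        ... | inj₂ (inj₁ bu≡yz) = there (there (there (here bu≡yz)))
        ... | inj₂ (inj₂ bu≡za) = ⊥-elim (chord-ax⇒≢za a~x ax≢yz bu≡za)

        palette-of-chord-ay : E a y → C a y ≢ C b x → C b u ∈ C b x ∷ C b y ∷ C x y ∷ C z a ∷ []
        palette-of-chord-ay a~y ay≢bx with colour
        ... | inj₁ bu≡xy = there (there (here bu≡xy))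
        ... | inj₂ (inj₁ bu≡yz) = ⊥-elim (chord-ay⇒≢yz a~y ay≢bx bu≡yz)
        ... | inj₂ (inj₂ bu≡za) = there (there (there (here bu≡za)))

        cycle-palette : C b u ∈ C b x ∷ C x y ∷ C y z ∷ C z a ∷ []
        cycle-palette with colour
        ... | inj₁ bu≡xy = there (here bu≡xy)
        ... | inj₂ (inj₁ bu≡yz) = there (there (here bu≡yz))
        ... | inj₂ (inj₂ bu≡za) = there (there (there (here bu≡za)))

      b-side-atMost : (ks : List ℕ) → C b x ∈ ks → (E b y → C b y ∈ ks) → (E b z → C b z ∈ ks) →
                      (∀ {u} → E b u → u ≢ a → u ≢ x → u ≢ y → u ≢ z → C b u ∈ ks) →
                      AtMost (length ks) (λ u → E b u × u ≢ a)
      b-side-atMost ks bx∈ by∈ bz∈ outside∈ = atMost-palette b ks ∘ Distinct-weaken (λ {u} → in-palette {u})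
        where
        in-palette : ∀ {u} → E b u × u ≢ a → E b u × C b u ∈ ks
        in-palette {u} (b~u , u≢a) with u Fin.≟ x | u Fin.≟ y | u Fin.≟ z
        ... | yes refl | _ | _ = b~u , bx∈
        ... | no _ | yes refl | _ = b~u , by∈ b~u
        ... | no _ | no _ | yes refl = b~u , bz∈ b~u
        ... | no u≢x | no u≢y | no u≢z = b~u , outside∈ b~u u≢a u≢x u≢y u≢z

      atMost-four-of-chord-ax : E a x → C a x ≢ C y z → AtMost 4 (λ u → E b u × u ≢ a)
      atMost-four-of-chord-ax a~x ax≢yz = b-side-atMost (C b x ∷ C b y ∷ C b z ∷ C y z ∷ [])
        (here refl) (λ _ → there (here refl)) (λ _ → there (there (here refl)))
        (λ b~u u≢a u≢x u≢y u≢z → Outside.palette-of-chord-ax b~u u≢a u≢x u≢y u≢z a~x ax≢yz)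

      atMost-four-of-chord-ay : E a y → C a y ≢ C b x → (E b z → C b z ≡ C x y) → AtMost 4 (λ u → E b u × u ≢ a)
      atMost-four-of-chord-ay a~y ay≢bx bz-forced = b-side-atMost (C b x ∷ C b y ∷ C x y ∷ C z a ∷ [])
        (here refl) (λ _ → there (here refl)) (λ b~z → there (there (here (bz-forced b~z))))
        (λ b~u u≢a u≢x u≢y u≢z → Outside.palette-of-chord-ay b~u u≢a u≢x u≢y u≢z a~y ay≢bx)

      atMost-four-of-forced-chords : (E b y → C b y ≡ C z a) → (E b z → C b z ≡ C x y) → AtMost 4 (λ u → E b u × u ≢ a)
      atMost-four-of-forced-chords by-forced bz-forced = b-side-atMost (C b x ∷ C x y ∷ C y z ∷ C z a ∷ [])
        (here refl) (λ b~y → there (there (there (here (by-forced b~y))))) (λ b~z → there (here (bz-forced b~z)))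
        Outside.cycle-palette

    one-side-small : ∀ {a b x y z} → RainbowPentagon a b x y z →
                     AtMost 4 (λ u → E b u × u ≢ a) ⊎ AtMost 4 (λ u → E a u × u ≢ b)
    one-side-small {a} {b} {x} {y} {z} g with edge-colour? a x (C y z)
    ... | inj₂ (a~x , ax≢yz) = inj₁ (Pentagon.atMost-four-of-chord-ax g a~x ax≢yz)
    ... | inj₁ ax-forced with edge-colour? b z (C x y)
    ...   | inj₂ (b~z , bz≢xy) = inj₂ (Pentagon.atMost-four-of-chord-ax (reverse g) b~z (bz≢xy ∘ flip-yx))
      where
      flip-yx : C b z ≡ C y x → C b z ≡ C x y
      flip-yx bz≡yx = trans bz≡yx (C-sym y x)
    ...   | inj₁ bz-forced with edge-colour? a y (C b x)
    ...     | inj₂ (a~y , ay≢bx) = inj₁ (Pentagon.atMost-four-of-chord-ay g a~y ay≢bx bz-forced)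
    ...     | inj₁ ay-forced = inj₂ (Pentagon.atMost-four-of-forced-chords (reverse g)
                                       (λ a~y → trans (ay-forced a~y) (C-sym b x)) (λ a~x → trans (ax-forced a~x) (C-sym y z)))

    -- Completions and branches of a fixed path a b x

    completion-colour : ∀ {a b x y z₁ z₂} → RainbowPentagon a b x y z₁ → RainbowPentagon a b x y z₂ → z₁ ≢ z₂ →
                        C y z₂ ≡ C z₁ a
    completion-colour {a} {b} {x} {y} {z₁} {z₂} g₁ g₂ z₁≢z₂ with C y z₂ ℕ.≟ C z₁ a
    ... | yes yz₂≡z₁a = yz₂≡z₁a
    ... | no yz₂≢z₁a = ⊥-elim (no-rainbow-path z₂ y x b a z₁
      (E-sym g₂.y~z) (E-sym x~y) (E-sym b~x) (E-sym a~b) (E-sym z~a) (C-sym z₂ y) (C-sym y x) (C-sym x b) (C-sym b a) (C-sym a z₁)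
      ((≢-sym g₂.y≢z ∷ ≢-sym g₂.x≢z ∷ ≢-sym g₂.b≢z ∷ ≢-sym g₂.a≢z ∷ ≢-sym z₁≢z₂ ∷ []) ∷
       (≢-sym x≢y ∷ ≢-sym b≢y ∷ ≢-sym a≢y ∷ y≢z ∷ []) ∷ (≢-sym b≢x ∷ ≢-sym a≢x ∷ x≢z ∷ []) ∷
       (≢-sym a≢b ∷ b≢z ∷ []) ∷ (a≢z ∷ []) ∷ [] ∷ [])
      ((≢-sym g₂.xy≢yz ∷ ≢-sym g₂.bx≢yz ∷ ≢-sym g₂.ab≢yz ∷ yz₂≢z₁a ∷ []) ∷
       (≢-sym bx≢xy ∷ ≢-sym ab≢xy ∷ xy≢za ∷ []) ∷ (≢-sym ab≢bx ∷ bx≢za ∷ []) ∷ (ab≢za ∷ []) ∷ [] ∷ []))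
      where
      open RainbowPentagon g₁
      module g₂ = RainbowPentagon g₂

    atMost-fifth-vertices : ∀ {a b x y} → AtMost 2 (RainbowPentagon a b x y)
    atMost-fifth-vertices (zs , zs-inj , gs) = z₁≢z₂ (colour-injective (y~z (gs (suc zero))) (y~z (gs (suc (suc zero))))
        (trans (completion-colour (gs zero) (gs (suc zero)) z₀≢z₁) (sym (completion-colour (gs zero) (gs (suc (suc zero))) z₀≢z₂))))
      where
      open RainbowPentagon using (y~z)
      z₀≢z₁ : zs zero ≢ zs (suc zero)
      z₀≢z₁ = (λ ()) ∘ zs-inj
      z₀≢z₂ : zs zero ≢ zs (suc (suc zero))
      z₀≢z₂ = (λ ()) ∘ zs-inj
      z₁≢z₂ : zs (suc zero) ≢ zs (suc (suc zero))
      z₁≢z₂ = (λ ()) ∘ zs-inj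

    branch-colour : ∀ {a b x y z y′ z′} → RainbowPentagon a b x y z → RainbowPentagon a b x y′ z′ → y′ ≢ y → y′ ≢ z →
                    C x y′ ≡ C y z ⊎ C x y′ ≡ C z a
    branch-colour {a} {b} {x} {y} {z} {y′} g g′ y′≢y y′≢z with C x y′ ℕ.≟ C y z | C x y′ ℕ.≟ C z a
    ... | yes xy′≡yz | _ = inj₁ xy′≡yz
    ... | no _ | yes xy′≡za = inj₂ xy′≡za
    ... | no xy′≢yz | no xy′≢za = ⊥-elim (no-rainbow-path y′ x b a z y
      (E-sym g′.x~y) (E-sym b~x) (E-sym a~b) (E-sym z~a) (E-sym y~z) (C-sym y′ x) (C-sym x b) (C-sym b a) (C-sym a z) (C-sym z y)
      ((≢-sym g′.x≢y ∷ ≢-sym g′.b≢y ∷ ≢-sym g′.a≢y ∷ y′≢z ∷ y′≢y ∷ []) ∷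
       (≢-sym b≢x ∷ ≢-sym a≢x ∷ x≢z ∷ x≢y ∷ []) ∷ (≢-sym a≢b ∷ b≢z ∷ b≢y ∷ []) ∷ (a≢z ∷ a≢y ∷ []) ∷ (≢-sym y≢z ∷ []) ∷ [] ∷ [])
      ((≢-sym g′.bx≢xy ∷ ≢-sym g′.ab≢xy ∷ xy′≢za ∷ xy′≢yz ∷ []) ∷
       (≢-sym ab≢bx ∷ bx≢za ∷ bx≢yz ∷ []) ∷ (ab≢za ∷ ab≢yz ∷ []) ∷ (≢-sym yz≢za ∷ []) ∷ [] ∷ []))
      where
      open RainbowPentagon g
      module g′ = RainbowPentagon g′

    completion-is-branch : ∀ {a b x y₁ z₁ y₂ z₂ y₃ z₃ y₄ z₄} →
      RainbowPentagon a b x y₁ z₁ → RainbowPentagon a b x y₂ z₂ → RainbowPentagon a b x y₃ z₃ → RainbowPentagon a b x y₄ z₄ →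
      y₁ ≢ y₂ → y₁ ≢ y₃ → y₁ ≢ y₄ → y₂ ≢ y₃ → y₂ ≢ y₄ → y₃ ≢ y₄ →
      z₁ ≡ y₂ ⊎ z₁ ≡ y₃ ⊎ z₁ ≡ y₄
    completion-is-branch {a} {x = x} {y₁} {z₁} {y₂} {_} {y₃} {_} {y₄} g₁ g₂ g₃ g₄ y₁≢y₂ y₁≢y₃ y₁≢y₄ y₂≢y₃ y₂≢y₄ y₃≢y₄
      with z₁ Fin.≟ y₂ | z₁ Fin.≟ y₃ | z₁ Fin.≟ y₄
    ... | yes z₁≡y₂ | _ | _ = inj₁ z₁≡y₂
    ... | no _ | yes z₁≡y₃ | _ = inj₂ (inj₁ z₁≡y₃)
    ... | no _ | no _ | yes z₁≡y₄ = inj₂ (inj₂ z₁≡y₄)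
    ... | no z₁≢y₂ | no z₁≢y₃ | no z₁≢y₄ = ⊥-elim (atMost-palette x (C y₁ z₁ ∷ C z₁ a ∷ [])
      (Uniqueᵛ⇒Distinct (y₂ ∷ y₃ ∷ y₄ ∷ []) ((y₂≢y₃ ∷ y₂≢y₄ ∷ []) ∷ (y₃≢y₄ ∷ []) ∷ [] ∷ [])
        (in-palette g₂ y₁≢y₂ z₁≢y₂ ∷ in-palette g₃ y₁≢y₃ z₁≢y₃ ∷ in-palette g₄ y₁≢y₄ z₁≢y₄ ∷ [])))
      where
      in-palette : ∀ {y z} → RainbowPentagon a _ x y z → y₁ ≢ y → z₁ ≢ y → E x y × C x y ∈ C y₁ z₁ ∷ C z₁ a ∷ []
      in-palette g y₁≢y z₁≢y = RainbowPentagon.x~y g , [ here , there ∘ here ]′ (branch-colour g₁ g (≢-sym y₁≢y) (≢-sym z₁≢y))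

    no-swapped-pair : ∀ {a b x y₁ y₂ y₃ z₃ y₄ z₄} →
      RainbowPentagon a b x y₁ y₂ → RainbowPentagon a b x y₂ y₁ → RainbowPentagon a b x y₃ z₃ → RainbowPentagon a b x y₄ z₄ →
      y₁ ≢ y₃ → y₁ ≢ y₄ → y₂ ≢ y₃ → y₂ ≢ y₄ → y₃ ≢ y₄ → ⊥
    no-swapped-pair {a} {b} {x} {y₁} {y₂} g₁ g₂ g₃ g₄ y₁≢y₃ y₁≢y₄ y₂≢y₃ y₂≢y₄ y₃≢y₄ =
      y₃≢y₄ (colour-injective (x~y g₃) (x~y g₄) (trans (colour-of g₃ y₁≢y₃ y₂≢y₃) (sym (colour-of g₄ y₁≢y₄ y₂≢y₄))))
      where
      open RainbowPentagon
      colour-of : ∀ {w z} → RainbowPentagon a b x w z → y₁ ≢ w → y₂ ≢ w → C x w ≡ C y₁ y₂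
      colour-of g y₁≢w y₂≢w with branch-colour g₁ g (≢-sym y₁≢w) (≢-sym y₂≢w) | branch-colour g₂ g (≢-sym y₂≢w) (≢-sym y₁≢w)
      ... | inj₁ xw≡y₁y₂ | _ = xw≡y₁y₂
      ... | inj₂ xw≡y₂a | inj₁ xw≡y₂y₁ = ⊥-elim (a≢y g₁ (colour-injective (z~a g₁) (y~z g₂) (trans (sym xw≡y₂a) xw≡y₂y₁)))
      ... | inj₂ xw≡y₂a | inj₂ xw≡y₁a = ⊥-elim (y≢z g₁ (sym (colour-injective (E-sym (z~a g₁)) (E-sym (z~a g₂))
                                            (trans (C-sym a y₂) (trans (sym xw≡y₂a) (trans xw≡y₁a (C-sym y₁ a)))))))

    no-chain : ∀ {a b x y₁ y₂ y₃ z₃ y₄ z₄} →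
      RainbowPentagon a b x y₁ y₂ → RainbowPentagon a b x y₂ y₃ → RainbowPentagon a b x y₃ z₃ → RainbowPentagon a b x y₄ z₄ →
      y₁ ≢ y₃ → y₁ ≢ y₄ → y₂ ≢ y₄ → y₃ ≢ y₄ → ⊥
    no-chain {a} {b} {x} {y₁} {y₂} {y₃} {_} {y₄} g₁ g₂ g₃ g₄ y₁≢y₃ y₁≢y₄ y₂≢y₄ y₃≢y₄ = compare-y₁y₂-xy₃ (C y₁ y₂ ℕ.≟ C x y₃)
      where
      module g₁ = RainbowPentagon g₁
      module g₂ = RainbowPentagon g₂
      module g₃ = RainbowPentagon g₃
      module g₄ = RainbowPentagon g₄

      y₁y₂≢y₂y₃ : C y₁ y₂ ≢ C y₂ y₃
      y₁y₂≢y₂y₃ y₁y₂≡y₂y₃ = proper-at (E-sym g₁.y~z) g₂.y~z y₁≢y₃ (trans (C-sym y₂ y₁) y₁y₂≡y₂y₃)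
      y₂y₃≢xy₃ : C y₂ y₃ ≢ C x y₃
      y₂y₃≢xy₃ y₂y₃≡xy₃ = proper-at (E-sym g₂.y~z) (E-sym g₃.x~y) (≢-sym g₂.x≢y) (trans (C-sym y₃ y₂) (trans y₂y₃≡xy₃ (C-sym x y₃)))

      compare-y₁y₂-xy₃ : Dec (C y₁ y₂ ≡ C x y₃) → ⊥
      compare-y₁y₂-xy₃ (no y₁y₂≢xy₃) = no-rainbow-path y₁ y₂ y₃ x b a
        g₁.y~z g₂.y~z (E-sym g₃.x~y) (E-sym g₁.b~x) (E-sym g₁.a~b) refl refl (C-sym y₃ x) (C-sym x b) (C-sym b a)
        ((g₁.y≢z ∷ y₁≢y₃ ∷ ≢-sym g₁.x≢y ∷ ≢-sym g₁.b≢y ∷ ≢-sym g₁.a≢y ∷ []) ∷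
         (g₂.y≢z ∷ ≢-sym g₂.x≢y ∷ ≢-sym g₂.b≢y ∷ ≢-sym g₂.a≢y ∷ []) ∷ (≢-sym g₃.x≢y ∷ ≢-sym g₃.b≢y ∷ ≢-sym g₃.a≢y ∷ []) ∷
         (≢-sym g₁.b≢x ∷ ≢-sym g₁.a≢x ∷ []) ∷ (≢-sym g₁.a≢b ∷ []) ∷ [] ∷ [])
        ((y₁y₂≢y₂y₃ ∷ y₁y₂≢xy₃ ∷ ≢-sym g₁.bx≢yz ∷ ≢-sym g₁.ab≢yz ∷ []) ∷
         (y₂y₃≢xy₃ ∷ ≢-sym g₂.bx≢yz ∷ ≢-sym g₂.ab≢yz ∷ []) ∷ (≢-sym g₃.bx≢xy ∷ ≢-sym g₃.ab≢xy ∷ []) ∷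
         (≢-sym g₁.ab≢bx ∷ []) ∷ [] ∷ [])
      compare-y₁y₂-xy₃ (yes y₁y₂≡xy₃) with branch-colour g₁ g₄ (≢-sym y₁≢y₄) (≢-sym y₂≢y₄) | branch-colour g₂ g₄ (≢-sym y₂≢y₄) (≢-sym y₃≢y₄)
      ... | inj₁ xy₄≡y₁y₂ | _ = y₃≢y₄ (colour-injective g₃.x~y g₄.x~y (trans (sym y₁y₂≡xy₃) (sym xy₄≡y₁y₂)))
      ... | inj₂ xy₄≡y₂a | inj₁ xy₄≡y₂y₃ = proper-at g₂.y~z g₁.z~a (≢-sym g₂.a≢z) (trans (sym xy₄≡y₂y₃) xy₄≡y₂a)
      ... | inj₂ xy₄≡y₂a | inj₂ xy₄≡y₃a = g₂.y≢z (colour-injective (E-sym g₁.z~a) (E-sym g₂.z~a)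
                                               (trans (C-sym a y₂) (trans (sym xy₄≡y₂a) (trans xy₄≡y₃a (C-sym y₃ a)))))

    no-linked-four-branches : ∀ {a b x y₁ y₂ z₂ y₃ z₃ y₄ z₄} →
      RainbowPentagon a b x y₁ y₂ → RainbowPentagon a b x y₂ z₂ → RainbowPentagon a b x y₃ z₃ → RainbowPentagon a b x y₄ z₄ →
      y₁ ≢ y₂ → y₁ ≢ y₃ → y₁ ≢ y₄ → y₂ ≢ y₃ → y₂ ≢ y₄ → y₃ ≢ y₄ → ⊥
    no-linked-four-branches g₁ g₂ g₃ g₄ y₁≢y₂ y₁≢y₃ y₁≢y₄ y₂≢y₃ y₂≢y₄ y₃≢y₄
      with completion-is-branch g₂ g₁ g₃ g₄ (≢-sym y₁≢y₂) y₂≢y₃ y₂≢y₄ y₁≢y₃ y₁≢y₄ y₃≢y₄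
    ... | inj₁ refl = no-swapped-pair g₁ g₂ g₃ g₄ y₁≢y₃ y₁≢y₄ y₂≢y₃ y₂≢y₄ y₃≢y₄
    ... | inj₂ (inj₁ refl) = no-chain g₁ g₂ g₃ g₄ y₁≢y₃ y₁≢y₄ y₂≢y₄ y₃≢y₄
    ... | inj₂ (inj₂ refl) = no-chain g₁ g₂ g₄ g₃ y₁≢y₄ y₁≢y₃ y₂≢y₃ (≢-sym y₃≢y₄)

    no-four-branches : ∀ {a b x y₁ z₁ y₂ z₂ y₃ z₃ y₄ z₄} →
      RainbowPentagon a b x y₁ z₁ → RainbowPentagon a b x y₂ z₂ → RainbowPentagon a b x y₃ z₃ → RainbowPentagon a b x y₄ z₄ →
      y₁ ≢ y₂ → y₁ ≢ y₃ → y₁ ≢ y₄ → y₂ ≢ y₃ → y₂ ≢ y₄ → y₃ ≢ y₄ → ⊥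
    no-four-branches g₁ g₂ g₃ g₄ y₁≢y₂ y₁≢y₃ y₁≢y₄ y₂≢y₃ y₂≢y₄ y₃≢y₄
      with completion-is-branch g₁ g₂ g₃ g₄ y₁≢y₂ y₁≢y₃ y₁≢y₄ y₂≢y₃ y₂≢y₄ y₃≢y₄
    ... | inj₁ refl = no-linked-four-branches g₁ g₂ g₃ g₄ y₁≢y₂ y₁≢y₃ y₁≢y₄ y₂≢y₃ y₂≢y₄ y₃≢y₄
    ... | inj₂ (inj₁ refl) = no-linked-four-branches g₁ g₃ g₂ g₄ y₁≢y₃ y₁≢y₂ y₁≢y₄ (≢-sym y₂≢y₃) y₃≢y₄ y₂≢y₄
    ... | inj₂ (inj₂ refl) = no-linked-four-branches g₁ g₄ g₂ g₃ y₁≢y₄ y₁≢y₂ y₁≢y₃ (≢-sym y₂≢y₄) (≢-sym y₃≢y₄) y₂≢y₃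

    atMost-fourth-vertices : ∀ {a b x} → AtMost 3 (λ y → Σ[ z ∈ Fin n ] RainbowPentagon a b x y z)
    atMost-fourth-vertices (ys , ys-inj , gs) =
      no-four-branches (proj₂ (gs zero)) (proj₂ (gs (suc zero))) (proj₂ (gs (suc (suc zero)))) (proj₂ (gs (suc (suc (suc zero)))))
        ((λ ()) ∘ ys-inj) ((λ ()) ∘ ys-inj) ((λ ()) ∘ ys-inj) ((λ ()) ∘ ys-inj) ((λ ()) ∘ ys-inj) ((λ ()) ∘ ys-inj)

    atMost-third-vertices : ∀ {k a b} → AtMost k (λ u → E b u × u ≢ a) →
                            AtMost k (λ x → Σ[ y ∈ Fin n ] Σ[ z ∈ Fin n ] RainbowPentagon a b x y z)
    atMost-third-vertices {a = a} {b} few = few ∘ Distinct-weaken (λ {x} → neighbour {x})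
      where
      neighbour : ∀ {x} → Σ[ y ∈ Fin n ] Σ[ z ∈ Fin n ] RainbowPentagon a b x y z → E b x × x ≢ a
      neighbour (_ , _ , g) = RainbowPentagon.b~x g , ≢-sym (RainbowPentagon.a≢x g)

lemma10 : (n : ℕ) (G : SimpleGraph n) (c : EdgeColouring G)
    → Proper c → NoRainbowP5 c
    → (a b : Fin n) → Edge G a b
    → (cs : List (Vec (Fin n) 5)) → Unique cs → All (RainbowC5Through c a b) cs
    → length cs ≤ 24
lemma10 n G c proper no-P₅ a b _ [] _ _ = z≤n
lemma10 n G c proper no-P₅ a b _ cs@(_ ∷ _) cs-unique rainbow =
  [ count-via-b , count-via-a ]′ (one-side-small (pentagon (here refl)))
  where
  open Colouring c
  open WithoutRainbowP₅ proper no-P₅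

  pentagon : ∀ {v} → v ∈ cs → RainbowPentagon a b (vertex₂ v) (vertex₃ v) (vertex₄ v)
  pentagon {v} v∈ = RainbowC5Through⇒pentagon v (All.lookup rainbow v∈)

  vertices : ∀ {v} → v ∈ cs → v ≡ a ∷ b ∷ vertex₂ v ∷ vertex₃ v ∷ vertex₄ v ∷ []
  vertices {v} v∈ = RainbowC5Through⇒≡ v (All.lookup rainbow v∈)

  count-via-b : AtMost 4 (λ u → E b u × u ≢ a) → length cs ≤ 24
  count-via-b few = length-≤-triples Fin._≟_ {R = RainbowPentagon a b}
    vertex₂ vertex₃ vertex₄ (λ (x , y , z) → a ∷ b ∷ x ∷ y ∷ z ∷ []) cs cs-unique pentagon vertices (atMost-third-vertices few) atMost-fourth-vertices atMost-fifth-vertices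

  count-via-a : AtMost 4 (λ u → E a u × u ≢ b) → length cs ≤ 24
  count-via-a few = length-≤-triples Fin._≟_ {R = RainbowPentagon b a}
    vertex₄ vertex₃ vertex₂ (λ (z , y , x) → a ∷ b ∷ x ∷ y ∷ z ∷ []) cs cs-unique (reverse ∘ pentagon) vertices (atMost-third-vertices few) atMost-fourth-vertices atMost-fifth-vertices
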